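{- If $G$ is a connected graph and $k\ge 3$ is an integer, then $$k\text{ - }\mathrm{gp_e}(G)\le (k-1)\cdot \mathrm{gcover_e}(G)\le (k-1)\cdot \mathrm{gpart_e}(G).$$
   Context: A geodesic is a shortest path. An edge $k$-general position set of $G$ is a set $S\subseteq E(G)$ with $|S\cap E(P)|\le k-1$ for every geodesic $P$ of $G$; $k\text{ - }\mathrm{gp_e}(G)$ is the maximum cardinality of such a set. An edge geodesic cover of $G$ is a set of geodesics such that every edge of $G$ lies on at least one of them; $\mathrm{gcover_e}(G)$ is the minimum cardinality of an edge geodesic cover. An edge geodesic partition of $G$ is a set of geodesics such that every edge of $G$ lies on exactly one of them; $\mathrm{gpart_e}(G)$ is the minimum cardinality of an edge geodesic partition. -}

module Defs where

open import Data.Nat using (ℕ; zero; suc; _≤_; _<_; _<ᵇ_)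
open import Data.Bool using (Bool; true; false; T; if_then_else_)
open import Data.Fin using (Fin; toℕ)
open import Data.Fin.Properties using (_≟_)
open import Data.Product using (Σ; ∃; _×_; _,_)
open import Data.Product.Properties using (≡-dec)
open import Data.List using (List; []; _∷_; length; filter)
open import Data.List.Relation.Unary.All using (All)
open import Data.List.Relation.Unary.Unique.Propositional using (Unique)
open import Relation.Binary.PropositionalEquality using (_≡_)
open import Relation.Nullary using (¬_)

record Graph : Set where
  field
    n     : ℕ
    adj   : Fin n → Fin n → Bool
    sym   : ∀ u v → adj u v ≡ adj v u
    irrefl : ∀ u → adj u u ≡ false
open Graph public

module _ (G : Graph) where

  Vertex : Set
  Vertex = Fin (n G)

  open import Data.List.Membership.DecPropositional (≡-dec (_≟_ {n G}) (_≟_ {n G})) using (_∈?_)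

  data Walk : Vertex → Vertex → Set where
    nil  : ∀ u → Walk u u
    cons : ∀ {u v w} → T (adj G u v) → Walk v w → Walk u w

  len : ∀ {u v} → Walk u v → ℕ
  len (nil _) = 0
  len (cons _ p) = suc (len p)

  -- an (undirected) edge is stored as a pair (i , j) with i < j
  RawEdge : Set
  RawEdge = Vertex × Vertex

  IsEdge : RawEdge → Set
  IsEdge (i , j) = (toℕ i < toℕ j) × T (adj G i j)

  normalize : Vertex → Vertex → RawEdge
  normalize a b = if toℕ a <ᵇ toℕ b then (a , b) else (b , a)

  edgesOf : ∀ {u v} → Walk u v → List RawEdge
  edgesOf (nil _) = []
  edgesOf (cons {u} {v} _ p) = normalize u v ∷ edgesOf p

  Connected : Set
  Connected = ∀ u v → Walk u v

  -- a geodesic: a shortest u,v-walk (hence a shortest path)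
  record Geodesic : Set where
    constructor geo
    field
      start end : Vertex
      walk : Walk start end
      shortest : ∀ (q : Walk start end) → len walk ≤ len q
  open Geodesic public

  geoEdges : Geodesic → List RawEdge
  geoEdges P = edgesOf (walk P)

  countOn : List RawEdge → Geodesic → ℕ
  countOn S P = length (filter (λ e → e ∈? geoEdges P) S)

  EdgeSet : List RawEdge → Set
  EdgeSet S = All IsEdge S × Unique S

  IsEdgeKGPSet : ℕ → List RawEdge → Set
  IsEdgeKGPSet k S = EdgeSet S × (∀ (P : Geodesic) → countOn S P ≤ k Data.Nat.∸ 1)

  IsEdgeKGPNumber : ℕ → ℕ → Set
  IsEdgeKGPNumber k m =
    (Σ (List RawEdge) λ S → IsEdgeKGPSet k S × length S ≡ m)
    × (∀ S → IsEdgeKGPSet k S → length S ≤ m)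

  multiplicity : List Geodesic → RawEdge → ℕ
  multiplicity C e = length (filter (λ P → e ∈? geoEdges P) C)

  IsEdgeGeodesicCover : List Geodesic → Set
  IsEdgeGeodesicCover C = ∀ e → IsEdge e → ¬ (multiplicity C e ≡ 0)

  IsEdgeGeodesicPartition : List Geodesic → Set
  IsEdgeGeodesicPartition C = ∀ e → IsEdge e → multiplicity C e ≡ 1

  IsGcoverNumber : ℕ → Set
  IsGcoverNumber m =
    (Σ (List Geodesic) λ C → IsEdgeGeodesicCover C × length C ≡ m)
    × (∀ C → IsEdgeGeodesicCover C → m ≤ length C)

  IsGpartNumber : ℕ → Set
  IsGpartNumber m =
    (Σ (List Geodesic) λ C → IsEdgeGeodesicPartition C × length C ≡ m)
    × (∀ C → IsEdgeGeodesicPartition C → m ≤ length C)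

{-# OPTIONS --safe #-}
module Submission where

-- Double counting: if S is an edge k-general position set and C an edge geodesic
-- cover, count the pairs (e , P) with e ∈ S, P ∈ C and e ∈ E(P).  Every e ∈ S lies
-- on some P ∈ C, so there are at least |S| such pairs; every geodesic P contains at
-- most k - 1 edges of S, so there are at most (k - 1)|C| of them.  The second
-- inequality holds because every edge geodesic partition is an edge geodesic cover.

open import Defs hiding (sym)
open import Data.Nat using (ℕ; _≤_; _*_; _∸_; _+_; z≤n)
open import Data.Nat.Properties
  using (≤-trans; ≤-reflexive; +-mono-≤; *-monoʳ-≤; *-zeroʳ; *-suc; 0≢1+n; n≢0⇒n>0; +-commutativeSemigroup; module ≤-Reasoning)
open import Data.Nat.ListAction using (sum)
open import Data.Product using (_×_; _,_)
open import Data.Fin.Properties using (_≟_)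
open import Data.Product.Properties using (≡-dec)
open import Data.List using ([]; _∷_; [_]; length; filter; map)
open import Data.List.Properties using (filter-++; length-++; map-cong)
open import Data.List.Relation.Unary.All using (All; []; _∷_)
import Data.List.Relation.Unary.All as All
open import Algebra.Properties.CommutativeSemigroup +-commutativeSemigroup using (interchange)
open import Relation.Nullary using (yes; no)
open import Relation.Unary using (Pred; Decidable)
open import Relation.Binary.PropositionalEquality
  using (_≡_; refl; sym; trans; cong; cong₂; module ≡-Reasoning)

module _ {A : Set} where

  length-filter-∷ : ∀ {p} {P : Pred A p} (P? : Decidable P) x xs →
    length (filter P? (x ∷ xs)) ≡ length (filter P? [ x ]) + length (filter P? xs)
  length-filter-∷ P? x xs = trans (cong length (filter-++ P? [ x ] xs)) (length-++ (filter P? [ x ]))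

  sum-map-+ : ∀ (f g : A → ℕ) xs → sum (map (λ x → f x + g x) xs) ≡ sum (map f xs) + sum (map g xs)
  sum-map-+ f g []       = refl
  sum-map-+ f g (x ∷ xs) = begin
    f x + g x + sum (map (λ x → f x + g x) xs)     ≡⟨ cong (f x + g x +_) (sum-map-+ f g xs) ⟩
    f x + g x + (sum (map f xs) + sum (map g xs))  ≡⟨ interchange (f x) (g x) _ _ ⟩
    f x + sum (map f xs) + (g x + sum (map g xs))  ∎
    where open ≡-Reasoning

  sum-map-≤ : ∀ (f : A → ℕ) m → (∀ x → f x ≤ m) → ∀ xs → sum (map f xs) ≤ m * length xs
  sum-map-≤ f m f≤m []       = ≤-reflexive (sym (*-zeroʳ m))
  sum-map-≤ f m f≤m (x ∷ xs) =
    ≤-trans (+-mono-≤ (f≤m x) (sum-map-≤ f m f≤m xs)) (≤-reflexive (sym (*-suc m (length xs))))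

  length≤sum-map : ∀ (f : A → ℕ) {xs} → All (λ x → 1 ≤ f x) xs → length xs ≤ sum (map f xs)
  length≤sum-map f []         = z≤n
  length≤sum-map f (1≤fx ∷ ps) = +-mono-≤ 1≤fx (length≤sum-map f ps)

module _ (G : Graph) where
  open import Data.List.Membership.DecPropositional (≡-dec (_≟_ {n G}) (_≟_ {n G})) using (_∈?_)

  countOn-∷ : ∀ e S P → countOn G (e ∷ S) P ≡ countOn G [ e ] P + countOn G S P
  countOn-∷ e S P = length-filter-∷ (_∈? geoEdges G P) e S

  multiplicity-∷ : ∀ e P C → multiplicity G (P ∷ C) e ≡ countOn G [ e ] P + multiplicity G C e
  multiplicity-∷ e P C with e ∈? geoEdges G P
  ... | yes _ = refl
  ... | no _  = refl

  sum-countOn-[] : ∀ C → sum (map (countOn G []) C) ≡ 0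
  sum-countOn-[] []      = refl
  sum-countOn-[] (_ ∷ C) = sum-countOn-[] C

  sum-countOn-[_] : ∀ e C → sum (map (countOn G [ e ]) C) ≡ multiplicity G C e
  sum-countOn-[ e ] []      = refl
  sum-countOn-[ e ] (P ∷ C) =
    trans (cong (countOn G [ e ] P +_) (sum-countOn-[ e ] C)) (sym (multiplicity-∷ e P C))

  double-counting : ∀ S C → sum (map (countOn G S) C) ≡ sum (map (multiplicity G C) S)
  double-counting []      C = sum-countOn-[] C
  double-counting (e ∷ S) C = begin
    sum (map (countOn G (e ∷ S)) C)
      ≡⟨ cong sum (map-cong (countOn-∷ e S) C) ⟩
    sum (map (λ P → countOn G [ e ] P + countOn G S P) C)
      ≡⟨ sum-map-+ (countOn G [ e ]) (countOn G S) C ⟩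
    sum (map (countOn G [ e ]) C) + sum (map (countOn G S) C)
      ≡⟨ cong₂ _+_ (sum-countOn-[ e ] C) (double-counting S C) ⟩
    multiplicity G C e + sum (map (multiplicity G C) S)  ∎
    where open ≡-Reasoning

  length≤bound*length-cover : ∀ {S C m} → All (IsEdge G) S → (∀ P → countOn G S P ≤ m) →
    IsEdgeGeodesicCover G C → length S ≤ m * length C
  length≤bound*length-cover {S} {C} {m} S⊆E bound cover = begin
    length S                          ≤⟨ length≤sum-map (multiplicity G C) (All.map covered S⊆E) ⟩
    sum (map (multiplicity G C) S)    ≡⟨ double-counting S C ⟨
    sum (map (countOn G S) C)         ≤⟨ sum-map-≤ (countOn G S) m bound C ⟩
    m * length C                      ∎
    where
      open ≤-Reasoning
      covered : ∀ {e} → IsEdge G e → 1 ≤ multiplicity G C e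
      covered {e} e∈E = n≢0⇒n>0 (cover e e∈E)

  partition⇒cover : ∀ {C} → IsEdgeGeodesicPartition G C → IsEdgeGeodesicCover G C
  partition⇒cover part e e∈E m≡0 = 0≢1+n (trans (sym m≡0) (part e e∈E))

lemma2p4 : (G : Graph) → Connected G → (k : ℕ) → 3 ≤ k →
    (a b c : ℕ) → IsEdgeKGPNumber G k a → IsGcoverNumber G b → IsGpartNumber G c →
    (a ≤ (k ∸ 1) * b) × ((k ∸ 1) * b ≤ (k ∸ 1) * c)
lemma2p4 G _ k _ _ _ _ ((S , ((S⊆E , _) , bound) , refl) , _) ((C , cover , refl) , minimal)
  ((D , partition , refl) , _) =
  length≤bound*length-cover G {C = C} S⊆E bound cover ,
  *-monoʳ-≤ (k ∸ 1) (minimal D (partition⇒cover G {D} partition))
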